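{- For every integer $n \geq 9$, \[\mathrm{sat}^*(n,C_5) \leq \left\lfloor \frac{5n}{2}\right\rfloor - 4.\]
   Context: An edge-coloring of a graph $G$ is a function $c: E(G)\to\mathbb{N}$; it is proper if any two edges sharing a vertex receive distinct colors. A subgraph is rainbow if all its edges receive distinct colors. Given a fixed graph $F$, a graph $G$ is (properly) rainbow $F$-saturated if (1) there exists a proper edge-coloring of $G$ with no rainbow subgraph isomorphic to $F$, and (2) for every pair of non-adjacent vertices $x,y$ of $G$, every proper edge-coloring of $G+xy$ contains a rainbow subgraph isomorphic to $F$. The proper rainbow saturation number $\mathrm{sat}^*(n,F)$ is the minimum number of edges in an $n$-vertex rainbow $F$-saturated graph. $C_5$ denotes the cycle on $5$ vertices. -}

module Defs where

open import Data.Nat using (ℕ; _<ᵇ_)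
open import Data.Bool using (Bool; true; false; _∧_; if_then_else_)
open import Data.Fin using (Fin; toℕ; zero; suc)
open import Data.List using (map; allFin)
open import Data.Nat.ListAction using (sum)
open import Data.Product using (Σ; _×_; _,_; ∃)
open import Data.Sum using (_⊎_)
open import Function.Definitions using (Injective)
open import Relation.Binary.PropositionalEquality using (_≡_; _≢_)
open import Relation.Nullary using (¬_)

record Graph (n : ℕ) : Set where
  field
    adj    : Fin n → Fin n → Bool
    sym    : ∀ x y → adj x y ≡ adj y x
    irrefl : ∀ x → adj x x ≡ false
open Graph public

Rel : ℕ → Set₁
Rel n = Fin n → Fin n → Set

Adj : ∀ {n} → Graph n → Rel n
Adj G x y = adj G x y ≡ true

AdjPlus : ∀ {n} → Graph n → Fin n → Fin n → Rel n
AdjPlus G x y u v = Adj G u v ⊎ ((u ≡ x × v ≡ y) ⊎ (u ≡ y × v ≡ x))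

edgeCount : ∀ {n} → Graph n → ℕ
edgeCount {n} G =
  sum (map (λ i → sum (map (λ j →
    if (toℕ i <ᵇ toℕ j) ∧ adj G i j then 1 else 0) (allFin n))) (allFin n))

-- An edge-colouring: a colour in ℕ for every unordered pair of vertices
-- (only values on edges matter), represented as a symmetric function.
record Colouring (n : ℕ) : Set where
  field
    col : Fin n → Fin n → ℕ
    col-sym : ∀ u v → col u v ≡ col v u
open Colouring public

Proper : ∀ {n} → Rel n → Colouring n → Set
Proper A c = ∀ u v w → A u v → A u w → v ≢ w → col c u v ≢ col c u w

next5 : Fin 5 → Fin 5
next5 zero = suc zero
next5 (suc zero) = suc (suc zero)
next5 (suc (suc zero)) = suc (suc (suc zero))
next5 (suc (suc (suc zero))) = suc (suc (suc (suc zero)))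
next5 (suc (suc (suc (suc zero)))) = zero

RainbowC5 : ∀ {n} → Rel n → Colouring n → Set
RainbowC5 {n} A c =
  Σ (Fin 5 → Fin n) λ v →
    Injective _≡_ _≡_ v ×
    (∀ i → A (v i) (v (next5 i))) ×
    Injective _≡_ _≡_ (λ i → col c (v i) (v (next5 i)))

RainbowC5Saturated : ∀ {n} → Graph n → Set
RainbowC5Saturated {n} G =
  (Σ (Colouring n) λ c → Proper (Adj G) c × ¬ RainbowC5 (Adj G) c) ×
  (∀ x y → x ≢ y → ¬ Adj G x y →
     ∀ (c : Colouring n) → Proper (AdjPlus G x y) c →
     RainbowC5 (AdjPlus G x y) c)

-- The graph is the edge UV joined to a maximum matching on the other n − 2 vertices; it has
-- ⌊5n/2⌋ − 4 edges. Colour U w by w, V w by the mate of w, UV by 1 and the matching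
-- edges by 0. Only U and V lie outside the matching, so a 5-cycle passes through a
-- matching edge ab flanked by U and V, and U a, b V have the same colour.
-- After adding a non-edge xy between two leaves, every proper colouring has a path
-- U a b V through leaves with c(Ua) ≠ c(bV): take xy itself, or else the matching edge
-- at x (or at y, when x is the unmatched last vertex). The pentagon U a b V z is then
-- rainbow unless z breaks one of six conditions, and by properness at U or V each
-- condition is broken by at most one leaf; since n ≥ 9 there are seven leaves to try.
module Submission where

open import Defs
open import Data.Bool using (Bool; true; false; _∧_; if_then_else_)
open import Data.Bool.Properties using (T-≡)
open import Data.Empty using (⊥; ⊥-elim)
import Data.Fin as Fin
open Fin using (Fin; zero; suc; toℕ; fromℕ; fromℕ<; inject₁; inject≤)
open import Data.Fin.Patterns using (0F; 1F; 2F; 3F; 4F; 5F)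
open import Data.Fin.Properties
  using (any?; all?; pigeonhole; <⇒≢; toℕ-injective; toℕ<n; toℕ≤pred[n]; toℕ-fromℕ; toℕ-fromℕ<;
         toℕ-inject₁; inject≤-injective)
  renaming (_≟_ to _≟ᶠ_; suc-injective to suc-injectiveᶠ)
open import Data.List using (allFin)
import Data.List as List
open import Data.List.Properties using (map-tabulate)
open import Data.Nat using (ℕ; zero; suc; _+_; _*_; _/_; _∸_; _<_; _≤_; _<ᵇ_; _≡ᵇ_; z≤n; s≤s)
open import Data.Nat.DivMod using (/-monoˡ-≤; m*n/n≡m)
open import Data.Nat.ListAction using (sum)
open import Data.Nat.Properties
  using (_≟_; _≤?_; ≤-refl; ≤-<-trans; m≤n⇒m<n∨m≡n; suc-injective; ≡ᵇ⇒≡; ≡⇒≡ᵇ; <⇒<ᵇ;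
         +-assoc; +-identityʳ; +-monoˡ-≤; n≤1+n; m+n≤o⇒m≤o∸n; +-0-commutativeMonoid)
open import Data.Nat.Tactic.RingSolver using (solve-∀)
open import Algebra.Properties.CommutativeMonoid.Sum +-0-commutativeMonoid
  using (sum-init-last; sum-cong-≗; sum-replicate-zero; ∑-distrib-+; sum-syntax)
  renaming (sum to ∑)
open import Data.Product using (Σ; _×_; _,_; ∃; ∃₂; proj₁; proj₂)
open import Data.Sum using (_⊎_; inj₁; inj₂)
open import Data.Vec using (Vec; []; _∷_; lookup; tabulate)
open import Data.Vec.Properties using (lookup∘tabulate)
open import Data.Vec.Relation.Unary.All using ([]; _∷_)
open import Data.Vec.Relation.Unary.AllPairs using ([]; _∷_)
open import Data.Vec.Relation.Unary.Unique.Propositional using (Unique)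
open import Data.Vec.Relation.Unary.Unique.Propositional.Properties using (lookup-injective)
open import Function using (_∘_; case_of_; Equivalence)
open import Function.Definitions using (Injective)
open import Relation.Binary.PropositionalEquality as ≡
  using (_≡_; _≢_; refl; subst; subst₂; cong; cong₂; ≢-sym)
open import Relation.Nullary using (¬_; Dec; yes; no; ¬?; _×-dec_)
open ≡.≡-Reasoning

∃-unblocked : ∀ {k m} (Blocks : Fin k → Fin m → Set) → (∀ r i → Dec (Blocks r i)) →
              (∀ r {i j} → i ≢ j → Blocks r i → Blocks r j → ⊥) →
              k < m → ∃ λ i → ∀ r → ¬ Blocks r i
∃-unblocked Blocks blocks? at-most-one k<m with any? (λ i → all? (λ r → ¬? (blocks? r i)))
... | yes unblocked = unblocked
... | no none = ⊥-elim (clash (pigeonhole k<m (proj₁ ∘ blocker)))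
  where
    blocker : ∀ i → ∃ λ r → Blocks r i
    blocker i with any? (λ r → blocks? r i)
    ... | yes blocked = blocked
    ... | no unblocked = ⊥-elim (none (i , λ r b → unblocked (r , b)))
    clash : (∃₂ λ i j → i Fin.< j × proj₁ (blocker i) ≡ proj₁ (blocker j)) → ⊥
    clash (i , j , i<j , same) =
      at-most-one _ (<⇒≢ i<j) (proj₂ (blocker i))
        (subst (λ r → Blocks r j) (≡.sym same) (proj₂ (blocker j)))

unique-tabulate⇒injective : ∀ {A : Set} {n} (f : Fin n → A) → Unique (tabulate f) → Injective _≡_ _≡_ f
unique-tabulate⇒injective f unique {i} {j} fi≡fj =
  lookup-injective unique i j
    (≡.trans (lookup∘tabulate f i) (≡.trans fi≡fj (≡.sym (lookup∘tabulate f j))))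

no-three-distinct-in-pair : ∀ {A : Set} {u v x y z : A} →
  x ≡ u ⊎ x ≡ v → y ≡ u ⊎ y ≡ v → z ≡ u ⊎ z ≡ v → x ≢ y → x ≢ z → y ≢ z → ⊥
no-three-distinct-in-pair (inj₁ refl) (inj₁ refl) _ x≢y _ _ = x≢y refl
no-three-distinct-in-pair (inj₂ refl) (inj₂ refl) _ x≢y _ _ = x≢y refl
no-three-distinct-in-pair (inj₁ refl) _ (inj₁ refl) _ x≢z _ = x≢z refl
no-three-distinct-in-pair (inj₂ refl) _ (inj₂ refl) _ x≢z _ = x≢z refl
no-three-distinct-in-pair _ (inj₁ refl) (inj₁ refl) _ _ y≢z = y≢z refl
no-three-distinct-in-pair _ (inj₂ refl) (inj₂ refl) _ _ y≢z = y≢z refl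

∀-via-next5 : {P : Fin 5 → Set} → (∀ i → P (next5 i)) → ∀ i → P i
∀-via-next5 h 0F = h 4F
∀-via-next5 h 1F = h 0F
∀-via-next5 h 2F = h 1F
∀-via-next5 h 3F = h 2F
∀-via-next5 h 4F = h 3F

next5²-≢ : ∀ i → i ≢ next5 (next5 i)
next5²-≢ 0F = λ ()
next5²-≢ 1F = λ ()
next5²-≢ 2F = λ ()
next5²-≢ 3F = λ ()
next5²-≢ 4F = λ ()

next5³-≢ : ∀ i → i ≢ next5 (next5 (next5 i))
next5³-≢ 0F = λ ()
next5³-≢ 1F = λ ()
next5³-≢ 2F = λ ()
next5³-≢ 3F = λ ()
next5³-≢ 4F = λ ()

C5-vertex-cover-has-three : (H : Fin 5 → Set) → (∀ i → H i ⊎ H (next5 i)) →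
  ¬ (∀ {i j k} → i ≢ j → i ≢ k → j ≢ k → H i → H j → H k → ⊥)
C5-vertex-cover-has-three H cover at-most-two
  with cover 4F | cover 0F | cover 2F | cover 1F | cover 3F
... | inj₁ h4 | inj₁ h0 | inj₁ h2 | _ | _ = at-most-two (λ ()) (λ ()) (λ ()) h0 h2 h4
... | inj₁ h4 | inj₁ h0 | inj₂ h3 | _ | _ = at-most-two (λ ()) (λ ()) (λ ()) h0 h3 h4
... | inj₁ h4 | inj₂ h1 | inj₁ h2 | _ | _ = at-most-two (λ ()) (λ ()) (λ ()) h1 h2 h4
... | inj₁ h4 | inj₂ h1 | inj₂ h3 | _ | _ = at-most-two (λ ()) (λ ()) (λ ()) h1 h3 h4
... | inj₂ h0 | _ | _ | inj₁ h1 | inj₁ h3 = at-most-two (λ ()) (λ ()) (λ ()) h0 h1 h3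
... | inj₂ h0 | _ | _ | inj₁ h1 | inj₂ h4 = at-most-two (λ ()) (λ ()) (λ ()) h0 h1 h4
... | inj₂ h0 | _ | _ | inj₂ h2 | inj₁ h3 = at-most-two (λ ()) (λ ()) (λ ()) h0 h2 h3
... | inj₂ h0 | _ | _ | inj₂ h2 | inj₂ h4 = at-most-two (λ ()) (λ ()) (λ ()) h0 h2 h4

Adj-sym : ∀ {n} (G : Graph n) {x y} → Adj G x y → Adj G y x
Adj-sym G {x} {y} x~y = ≡.trans (sym G y x) x~y

adjacent⇒≢ : ∀ {n} (G : Graph n) {u v} → Adj G u v → u ≢ v
adjacent⇒≢ G {u} u~u refl = case ≡.trans (≡.sym (irrefl G u)) u~u of λ ()

AdjPlus-sym : ∀ {n} (G : Graph n) x y {u v} → AdjPlus G x y u v → AdjPlus G x y v u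
AdjPlus-sym G _ _ (inj₁ u~v) = inj₁ (Adj-sym G u~v)
AdjPlus-sym G _ _ (inj₂ (inj₁ (u≡x , v≡y))) = inj₂ (inj₂ (v≡y , u≡x))
AdjPlus-sym G _ _ (inj₂ (inj₂ (u≡y , v≡x))) = inj₂ (inj₁ (v≡x , u≡y))

module MatchingJoin {n} (G : Graph n) (c : Colouring n) {U V : Fin n}
  {Leaf : Fin n → Set} (leaf? : ∀ x → Dec (Leaf x))
  (hub : ∀ {x} → ¬ Leaf x → x ≡ U ⊎ x ≡ V)
  (matching : ∀ {a b d} → Leaf a → Leaf b → Leaf d → Adj G b a → Adj G b d → a ≡ d)
  (mates-share-colour : ∀ {a b} → Leaf a → Leaf b → Adj G a b → col c U a ≡ col c b V)
  where

  outer-edges-share-colour : ∀ {p a b q} → Leaf a → Leaf b → Adj G a b →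
                             ¬ Leaf p → ¬ Leaf q → p ≢ q → col c p a ≡ col c b q
  outer-edges-share-colour {a = a} {b} la lb a~b hub-p hub-q p≢q with hub hub-p | hub hub-q
  ... | inj₁ refl | inj₂ refl = mates-share-colour la lb a~b
  ... | inj₂ refl | inj₁ refl = begin
    col c V a ≡⟨ col-sym c V a ⟩
    col c a V ≡⟨ mates-share-colour lb la (Adj-sym G a~b) ⟨
    col c U b ≡⟨ col-sym c U b ⟩
    col c b U ∎
  ... | inj₁ refl | inj₁ refl = ⊥-elim (p≢q refl)
  ... | inj₂ refl | inj₂ refl = ⊥-elim (p≢q refl)

  no-rainbow-C5 : ¬ RainbowC5 (Adj G) c
  no-rainbow-C5 (v , v-inj , edge , colour-inj)
    with any? (λ j → leaf? (v (next5 j)) ×-dec leaf? (v (next5 (next5 j))))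
  ... | yes (j , la , lb) =
    next5²-≢ j (colour-inj
      (outer-edges-share-colour la lb (edge (next5 j)) hub-p hub-q (next5³-≢ j ∘ v-inj)))
    where
      hub-p : ¬ Leaf (v j)
      hub-p lp = next5²-≢ j (v-inj (matching lp la lb (Adj-sym G (edge j)) (edge (next5 j))))
      hub-q : ¬ Leaf (v (next5 (next5 (next5 j))))
      hub-q lq = next5²-≢ (next5 j)
        (v-inj (matching la lb lq (Adj-sym G (edge (next5 j))) (edge (next5 (next5 j)))))
  ... | no none = C5-vertex-cover-has-three (λ i → ¬ Leaf (v i)) (∀-via-next5 cover)
      λ i≢j i≢k j≢k hi hj hk →
        no-three-distinct-in-pair (hub hi) (hub hj) (hub hk) (i≢j ∘ v-inj) (i≢k ∘ v-inj) (j≢k ∘ v-inj)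
    where
      cover : ∀ j → ¬ Leaf (v (next5 j)) ⊎ ¬ Leaf (v (next5 (next5 j)))
      cover j with leaf? (v (next5 j))
      ... | yes la = inj₂ (λ lb → none (j , la , lb))
      ... | no hub-a = inj₁ hub-a

module RainbowPentagon {n} (E : Rel n) (E-sym : ∀ {u v} → E u v → E v u)
  (c : Colouring n) (proper : Proper E c) {U V : Fin n} (U≢V : U ≢ V)
  (Leaf : Fin n → Set)
  (leaf≢U : ∀ {z} → Leaf z → z ≢ U) (leaf≢V : ∀ {z} → Leaf z → z ≢ V)
  (U~leaf : ∀ {z} → Leaf z → E U z) (V~leaf : ∀ {z} → Leaf z → E V z)
  (candidate : Fin 7 → Fin n) (candidate-injective : Injective _≡_ _≡_ candidate)
  (candidate-leaf : ∀ k → Leaf (candidate k))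
  where

  module _ {a b} (la : Leaf a) (lb : Leaf b) (a≢b : a ≢ b) (a~b : E a b)
           (Ua≢bV : col c U a ≢ col c b V) where

    Blocks : Fin 6 → Fin n → Set
    Blocks 0F z = z ≡ a
    Blocks 1F z = z ≡ b
    Blocks 2F z = col c V z ≡ col c U a
    Blocks 3F z = col c V z ≡ col c a b
    Blocks 4F z = col c U z ≡ col c a b
    Blocks 5F z = col c U z ≡ col c b V

    blocks? : ∀ r z → Dec (Blocks r z)
    blocks? 0F z = z ≟ᶠ a
    blocks? 1F z = z ≟ᶠ b
    blocks? 2F z = col c V z ≟ col c U a
    blocks? 3F z = col c V z ≟ col c a b
    blocks? 4F z = col c U z ≟ col c a b
    blocks? 5F z = col c U z ≟ col c b V

    blocks-at-most-one : ∀ r {z w} → Leaf z → Leaf w → z ≢ w → Blocks r z → Blocks r w → ⊥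
    blocks-at-most-one 0F _ _ z≢w z≡a w≡a = z≢w (≡.trans z≡a (≡.sym w≡a))
    blocks-at-most-one 1F _ _ z≢w z≡b w≡b = z≢w (≡.trans z≡b (≡.sym w≡b))
    blocks-at-most-one 2F lz lw z≢w p q = proper V _ _ (V~leaf lz) (V~leaf lw) z≢w (≡.trans p (≡.sym q))
    blocks-at-most-one 3F lz lw z≢w p q = proper V _ _ (V~leaf lz) (V~leaf lw) z≢w (≡.trans p (≡.sym q))
    blocks-at-most-one 4F lz lw z≢w p q = proper U _ _ (U~leaf lz) (U~leaf lw) z≢w (≡.trans p (≡.sym q))
    blocks-at-most-one 5F lz lw z≢w p q = proper U _ _ (U~leaf lz) (U~leaf lw) z≢w (≡.trans p (≡.sym q))

    module Pentagon {z} (lz : Leaf z) (unblocked : ∀ r → ¬ Blocks r z) where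

      cycle : Vec (Fin n) 5
      cycle = U ∷ a ∷ b ∷ V ∷ z ∷ []

      a≢z : a ≢ z
      a≢z = ≢-sym (unblocked 0F)

      b≢z : b ≢ z
      b≢z = ≢-sym (unblocked 1F)

      cycle-unique : Unique cycle
      cycle-unique =
        (≢-sym (leaf≢U la) ∷ ≢-sym (leaf≢U lb) ∷ U≢V ∷ ≢-sym (leaf≢U lz) ∷ []) ∷
        (a≢b ∷ leaf≢V la ∷ a≢z ∷ []) ∷
        (leaf≢V lb ∷ b≢z ∷ []) ∷
        (≢-sym (leaf≢V lz) ∷ []) ∷ [] ∷ []

      cycle-edge : ∀ i → E (lookup cycle i) (lookup cycle (next5 i))
      cycle-edge 0F = U~leaf la
      cycle-edge 1F = a~b
      cycle-edge 2F = E-sym (V~leaf lb)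
      cycle-edge 3F = V~leaf lz
      cycle-edge 4F = E-sym (U~leaf lz)

      cycle-colours-unique : Unique (col c U a ∷ col c a b ∷ col c b V ∷ col c V z ∷ col c z U ∷ [])
      cycle-colours-unique =
        ( (λ e → proper a U b (E-sym (U~leaf la)) a~b (≢-sym (leaf≢U lb)) (≡.trans (col-sym c a U) e))
        ∷ Ua≢bV
        ∷ (λ e → unblocked 2F (≡.sym e))
        ∷ (λ e → proper U a z (U~leaf la) (U~leaf lz) a≢z (≡.trans e (col-sym c z U)))
        ∷ []) ∷
        ( (λ e → proper b a V (E-sym a~b) (E-sym (V~leaf lb)) (leaf≢V la) (≡.trans (col-sym c b a) e))
        ∷ (λ e → unblocked 3F (≡.sym e))
        ∷ (λ e → unblocked 4F (≡.trans (col-sym c U z) (≡.sym e)))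
        ∷ []) ∷
        ( (λ e → proper V b z (V~leaf lb) (V~leaf lz) b≢z (≡.trans (col-sym c V b) e))
        ∷ (λ e → unblocked 5F (≡.trans (col-sym c U z) (≡.sym e)))
        ∷ []) ∷
        ( (λ e → proper z V U (E-sym (V~leaf lz)) (E-sym (U~leaf lz)) (≢-sym U≢V) (≡.trans (col-sym c z V) e))
        ∷ []) ∷ [] ∷ []

      rainbow : RainbowC5 E c
      rainbow = lookup cycle , unique-tabulate⇒injective (lookup cycle) cycle-unique ,
                cycle-edge , unique-tabulate⇒injective _ cycle-colours-unique

    rainbow-C5 : RainbowC5 E c
    rainbow-C5
      with ∃-unblocked (λ r k → Blocks r (candidate k)) (λ r k → blocks? r (candidate k))
             (λ r k≢l → blocks-at-most-one r (candidate-leaf _) (candidate-leaf _) (k≢l ∘ candidate-injective))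
             ≤-refl
    ... | k , unblocked = Pentagon.rainbow (candidate-leaf k) unblocked

<ᵇ-true : ∀ {i n} → i < n → (i <ᵇ n) ≡ true
<ᵇ-true i<n = Equivalence.to T-≡ (<⇒<ᵇ i<n)

≤⇒≮ᵇ : ∀ {j n} → j ≤ n → (n <ᵇ j) ≡ false
≤⇒≮ᵇ z≤n = refl
≤⇒≮ᵇ (s≤s j≤n) = ≤⇒≮ᵇ j≤n

sum-allFin : ∀ {n} (f : Fin n → ℕ) → sum (List.map f (allFin n)) ≡ ∑ f
sum-allFin {n} f = ≡.trans (cong sum (map-tabulate {n = n} (λ i → i) f)) (sum-tabulate f)
  where
    sum-tabulate : ∀ {n} (f : Fin n → ℕ) → sum (List.tabulate f) ≡ ∑ f
    sum-tabulate {zero} f = refl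
    sum-tabulate {suc n} f = cong (f zero +_) (sum-tabulate (f ∘ suc))

∑-toℕ-suc : ∀ n (f : ℕ → ℕ) → ∑[ i < suc n ] f (toℕ i) ≡ ∑[ i < n ] f (toℕ i) + f n
∑-toℕ-suc n f = begin
  ∑[ i < suc n ] f (toℕ i)
    ≡⟨ sum-init-last (f ∘ toℕ) ⟩
  ∑[ i < n ] f (toℕ (inject₁ i)) + f (toℕ (fromℕ n))
    ≡⟨ cong₂ _+_ (sum-cong-≗ {n} (cong f ∘ toℕ-inject₁)) (cong f (toℕ-fromℕ n)) ⟩
  ∑[ i < n ] f (toℕ i) + f n
    ∎

module Counting (a : ℕ → ℕ → Bool) where

  ascendingEdge : ℕ → ℕ → ℕ
  ascendingEdge i j = if (i <ᵇ j) ∧ a i j then 1 else 0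

  edgesBelow : ℕ → ℕ
  edgesBelow n = ∑[ i < n ] ∑[ j < n ] ascendingEdge (toℕ i) (toℕ j)

  backDegree : ℕ → ℕ
  backDegree n = ∑[ i < n ] (if a (toℕ i) n then 1 else 0)

  edgesBelow-suc : ∀ n → edgesBelow (suc n) ≡ edgesBelow n + backDegree n
  edgesBelow-suc n = begin
    edgesBelow (suc n)
      ≡⟨ ∑-toℕ-suc n (λ i → row i (suc n)) ⟩
    ∑[ i < n ] row (toℕ i) (suc n) + row n (suc n)
      ≡⟨ cong₂ _+_ (sum-cong-≗ {n} λ i → ∑-toℕ-suc n (ascendingEdge (toℕ i))) last-row-empty ⟩
    ∑[ i < n ] (row (toℕ i) n + ascendingEdge (toℕ i) n) + 0
      ≡⟨ +-identityʳ _ ⟩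
    ∑[ i < n ] (row (toℕ i) n + ascendingEdge (toℕ i) n)
      ≡⟨ ∑-distrib-+ {n} (λ i → row (toℕ i) n) (λ i → ascendingEdge (toℕ i) n) ⟩
    edgesBelow n + ∑[ i < n ] ascendingEdge (toℕ i) n
      ≡⟨ cong (edgesBelow n +_) (sum-cong-≗ {n} λ i →
           cong (λ b → if b ∧ a (toℕ i) n then 1 else 0) (<ᵇ-true (toℕ<n i))) ⟩
    edgesBelow n + backDegree n
      ∎
    where
      row : ℕ → ℕ → ℕ
      row i m = ∑[ j < m ] ascendingEdge i (toℕ j)
      last-row-empty : row n (suc n) ≡ 0
      last-row-empty = ≡.trans
        (sum-cong-≗ {suc n} λ j → cong (λ b → if b ∧ a n (toℕ j) then 1 else 0) (≤⇒≮ᵇ (toℕ≤pred[n] j)))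
        (sum-replicate-zero (suc n))

2≤2+ : ∀ {k} → 2 ≤ 2 + k
2≤2+ = s≤s (s≤s z≤n)

mate : ℕ → ℕ
mate 0 = 1
mate 1 = 0
mate (suc (suc k)) = suc (suc (mate k))

mate-involutive : ∀ k → mate (mate k) ≡ k
mate-involutive 0 = refl
mate-involutive 1 = refl
mate-involutive (suc (suc k)) = cong (2 +_) (mate-involutive k)

mate-injective : ∀ {i j} → mate i ≡ mate j → i ≡ j
mate-injective {i} {j} e = begin
  i             ≡⟨ mate-involutive i ⟨
  mate (mate i) ≡⟨ cong mate e ⟩
  mate (mate j) ≡⟨ mate-involutive j ⟩
  j             ∎

mate-≢ : ∀ k → mate k ≢ k
mate-≢ 0 = λ ()
mate-≢ 1 = λ ()
mate-≢ (suc (suc k)) = mate-≢ k ∘ suc-injective ∘ suc-injective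

mate-≤ : ∀ k → mate k ≤ suc k
mate-≤ 0 = ≤-refl
mate-≤ 1 = z≤n
mate-≤ (suc (suc k)) = s≤s (s≤s (mate-≤ k))

mate-≡ᵇ-irrefl : ∀ k → (mate k ≡ᵇ k) ≡ false
mate-≡ᵇ-irrefl 0 = refl
mate-≡ᵇ-irrefl 1 = refl
mate-≡ᵇ-irrefl (suc (suc k)) = mate-≡ᵇ-irrefl k

mate-≡ᵇ-sym : ∀ i j → (mate i ≡ᵇ j) ≡ (mate j ≡ᵇ i)
mate-≡ᵇ-sym 0 0 = refl
mate-≡ᵇ-sym 0 1 = refl
mate-≡ᵇ-sym 0 (suc (suc j)) = refl
mate-≡ᵇ-sym 1 0 = refl
mate-≡ᵇ-sym 1 1 = refl
mate-≡ᵇ-sym 1 (suc (suc j)) = refl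
mate-≡ᵇ-sym (suc (suc i)) 0 = refl
mate-≡ᵇ-sym (suc (suc i)) 1 = refl
mate-≡ᵇ-sym (suc (suc i)) (suc (suc j)) = mate-≡ᵇ-sym i j

mate-in-range-or-last : ∀ {w N} → w < N → mate w < N ⊎ suc w ≡ N
mate-in-range-or-last w<N with m≤n⇒m<n∨m≡n w<N
... | inj₁ 1+w<N = inj₁ (≤-<-trans (mate-≤ _) 1+w<N)
... | inj₂ 1+w≡N = inj₂ 1+w≡N

-- Vertex 0 is U, vertex 1 is V, and every w ≥ 2 is a leaf matched to mate w.
adjᴺ : ℕ → ℕ → Bool
adjᴺ 0 0 = false
adjᴺ 0 (suc j) = true
adjᴺ (suc i) 0 = true
adjᴺ 1 1 = false
adjᴺ 1 (suc (suc j)) = true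
adjᴺ (suc (suc i)) 1 = true
adjᴺ i@(suc (suc _)) j@(suc (suc _)) = mate i ≡ᵇ j

colᴺ : ℕ → ℕ → ℕ
colᴺ 0 j = j
colᴺ (suc i) 0 = suc i
colᴺ 1 1 = 0
colᴺ 1 j@(suc (suc _)) = mate j
colᴺ i@(suc (suc _)) 1 = mate i
colᴺ (suc (suc _)) (suc (suc _)) = 0

adjᴺ-sym : ∀ i j → adjᴺ i j ≡ adjᴺ j i
adjᴺ-sym 0 0 = refl
adjᴺ-sym 0 (suc j) = refl
adjᴺ-sym (suc i) 0 = refl
adjᴺ-sym 1 1 = refl
adjᴺ-sym 1 (suc (suc j)) = refl
adjᴺ-sym (suc (suc i)) 1 = refl
adjᴺ-sym (suc (suc i)) (suc (suc j)) = mate-≡ᵇ-sym i j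

adjᴺ-irrefl : ∀ i → adjᴺ i i ≡ false
adjᴺ-irrefl 0 = refl
adjᴺ-irrefl 1 = refl
adjᴺ-irrefl (suc (suc i)) = mate-≡ᵇ-irrefl i

colᴺ-sym : ∀ i j → colᴺ i j ≡ colᴺ j i
colᴺ-sym 0 0 = refl
colᴺ-sym 0 (suc j) = refl
colᴺ-sym (suc i) 0 = refl
colᴺ-sym 1 1 = refl
colᴺ-sym 1 (suc (suc j)) = refl
colᴺ-sym (suc (suc i)) 1 = refl
colᴺ-sym (suc (suc i)) (suc (suc j)) = refl

hubs-see-leaves : ∀ {w} → 2 ≤ w → adjᴺ 0 w ≡ true × adjᴺ 1 w ≡ true
hubs-see-leaves (s≤s (s≤s _)) = refl , refl

adjacent-leaves-are-mates : ∀ {i j} → 2 ≤ i → 2 ≤ j → adjᴺ i j ≡ true → mate i ≡ j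
adjacent-leaves-are-mates (s≤s (s≤s _)) (s≤s (s≤s _)) e = ≡ᵇ⇒≡ _ _ (Equivalence.from T-≡ e)

leaf-adjacent-to-mate : ∀ {i} → 2 ≤ i → adjᴺ i (mate i) ≡ true
leaf-adjacent-to-mate {suc (suc k)} (s≤s (s≤s _)) = Equivalence.to T-≡ (≡⇒≡ᵇ (mate k) (mate k) refl)

mate-of-leaf : ∀ {i} → 2 ≤ i → 2 ≤ mate i
mate-of-leaf (s≤s (s≤s _)) = 2≤2+

non-neighbour-is-leaf : ∀ {i j} → i ≢ j → adjᴺ i j ≢ true → 2 ≤ i
non-neighbour-is-leaf {0} {0} i≢j _ = ⊥-elim (i≢j refl)
non-neighbour-is-leaf {0} {suc j} _ i≁j = ⊥-elim (i≁j refl)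
non-neighbour-is-leaf {1} {0} _ i≁j = ⊥-elim (i≁j refl)
non-neighbour-is-leaf {1} {1} i≢j _ = ⊥-elim (i≢j refl)
non-neighbour-is-leaf {1} {suc (suc j)} _ i≁j = ⊥-elim (i≁j refl)
non-neighbour-is-leaf {suc (suc i)} _ _ = 2≤2+

mates-share-colourᴺ : ∀ {i j} → 2 ≤ i → 2 ≤ j → adjᴺ i j ≡ true → colᴺ 0 i ≡ colᴺ j 1
mates-share-colourᴺ {j = 1} _ (s≤s ()) _
mates-share-colourᴺ {i} {suc (suc k)} li lj i~j = begin
  i             ≡⟨ mate-involutive i ⟨
  mate (mate i) ≡⟨ cong mate (adjacent-leaves-are-mates li lj i~j) ⟩
  mate (2 + k)  ∎

colᴺ-injective : ∀ u {v w} → adjᴺ u v ≡ true → adjᴺ u w ≡ true → colᴺ u v ≡ colᴺ u w → v ≡ w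
colᴺ-injective 0 _ _ e = e
colᴺ-injective 1 {0} {0} _ _ _ = refl
colᴺ-injective 1 {0} {suc (suc _)} _ _ ()
colᴺ-injective 1 {suc (suc _)} {0} _ _ ()
colᴺ-injective 1 {suc (suc _)} {suc (suc _)} _ _ e = mate-injective e
colᴺ-injective 1 {1} ()
colᴺ-injective 1 {_} {1} _ ()
colᴺ-injective (suc (suc _)) {0} {0} _ _ _ = refl
colᴺ-injective (suc (suc _)) {1} {1} _ _ _ = refl
colᴺ-injective u@(suc (suc _)) {0} {1} _ _ e = ⊥-elim (mate-≢ u (≡.sym e))
colᴺ-injective u@(suc (suc _)) {1} {0} _ _ e = ⊥-elim (mate-≢ u e)
colᴺ-injective (suc (suc _)) {0} {suc (suc _)} _ _ ()
colᴺ-injective (suc (suc _)) {1} {suc (suc _)} _ _ ()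
colᴺ-injective (suc (suc _)) {suc (suc _)} {0} _ _ ()
colᴺ-injective (suc (suc _)) {suc (suc _)} {1} _ _ ()
colᴺ-injective (suc (suc u)) {suc (suc v)} {suc (suc w)} u~v u~w _ =
  ≡.trans (≡.sym (adjacent-leaves-are-mates (2≤2+ {u}) (2≤2+ {v}) u~v))
          (adjacent-leaves-are-mates (2≤2+ {u}) (2≤2+ {w}) u~w)

graph : ∀ n → Graph n
graph n = record
  { adj    = λ i j → adjᴺ (toℕ i) (toℕ j)
  ; sym    = λ i j → adjᴺ-sym (toℕ i) (toℕ j)
  ; irrefl = λ i → adjᴺ-irrefl (toℕ i)
  }

colouring : ∀ n → Colouring n
colouring n = record
  { col     = λ i j → colᴺ (toℕ i) (toℕ j)
  ; col-sym = λ i j → colᴺ-sym (toℕ i) (toℕ j)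
  }

colouring-proper : ∀ n → Proper (Adj (graph n)) (colouring n)
colouring-proper n u v w u~v u~w v≢w e = v≢w (toℕ-injective (colᴺ-injective (toℕ u) u~v u~w e))

module _ (m : ℕ) (7≤m : 7 ≤ m) where

  private
    N = 2 + m
    G = graph N
    U V : Fin N
    U = zero
    V = suc zero

  Leaf : Fin N → Set
  Leaf z = 2 ≤ toℕ z

  hub : ∀ {x} → ¬ Leaf x → x ≡ U ⊎ x ≡ V
  hub {zero} _ = inj₁ refl
  hub {suc zero} _ = inj₂ refl
  hub {suc (suc _)} not-leaf = ⊥-elim (not-leaf 2≤2+)

  no-rainbow-C5 : ¬ RainbowC5 (Adj G) (colouring N)
  no-rainbow-C5 = MatchingJoin.no-rainbow-C5 G (colouring N) (λ x → 2 ≤? toℕ x) hub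
    (λ la lb ld b~a b~d → toℕ-injective
      (≡.trans (≡.sym (adjacent-leaves-are-mates lb la b~a)) (adjacent-leaves-are-mates lb ld b~d)))
    mates-share-colourᴺ

  leaf≢U : ∀ {z} → Leaf z → z ≢ U
  leaf≢U () refl

  leaf≢V : ∀ {z} → Leaf z → z ≢ V
  leaf≢V (s≤s ()) refl

  candidate : Fin 7 → Fin N
  candidate k = suc (suc (inject≤ k 7≤m))

  candidate-injective : Injective _≡_ _≡_ candidate
  candidate-injective = inject≤-injective _ _ _ _ ∘ suc-injectiveᶠ ∘ suc-injectiveᶠ

  mate-vertex : ∀ {w} → Leaf w → mate (toℕ w) < N → Σ (Fin N) λ w′ → Leaf w′ × Adj G w w′
  mate-vertex {w} lw lt =
    fromℕ< lt ,
    subst (2 ≤_) (≡.sym (toℕ-fromℕ< lt)) (mate-of-leaf lw) ,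
    subst (λ t → adjᴺ (toℕ w) t ≡ true) (≡.sym (toℕ-fromℕ< lt)) (leaf-adjacent-to-mate lw)

  module _ {x y : Fin N} (x≢y : x ≢ y) (x≁y : ¬ Adj G x y)
           {c : Colouring N} (proper : Proper (AdjPlus G x y) c) where

    leaf-x : Leaf x
    leaf-x = non-neighbour-is-leaf (x≢y ∘ toℕ-injective) x≁y

    leaf-y : Leaf y
    leaf-y = non-neighbour-is-leaf (≢-sym x≢y ∘ toℕ-injective) (x≁y ∘ Adj-sym G {y} {x})

    U~leaf : ∀ {z} → Leaf z → AdjPlus G x y U z
    U~leaf lz = inj₁ (proj₁ (hubs-see-leaves lz))

    V~leaf : ∀ {z} → Leaf z → AdjPlus G x y V z
    V~leaf lz = inj₁ (proj₂ (hubs-see-leaves lz))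

    open RainbowPentagon (AdjPlus G x y) (AdjPlus-sym G x y) c proper (λ ()) Leaf
                         leaf≢U leaf≢V U~leaf V~leaf candidate candidate-injective (λ _ → 2≤2+)

    via-mate-of-x : col c U x ≡ col c y V → mate (toℕ x) < N → RainbowC5 (AdjPlus G x y) c
    via-mate-of-x Ux≡yV x′<N with mate-vertex leaf-x x′<N
    ... | x′ , leaf-x′ , x~x′ =
      rainbow-C5 leaf-x leaf-x′ (adjacent⇒≢ G x~x′) (inj₁ x~x′) λ Ux≡x′V →
        proper V y x′ (V~leaf leaf-y) (V~leaf leaf-x′) (λ { refl → x≁y x~x′ }) (begin
          col c V y  ≡⟨ col-sym c V y ⟩
          col c y V  ≡⟨ Ux≡yV ⟨
          col c U x  ≡⟨ Ux≡x′V ⟩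
          col c x′ V ≡⟨ col-sym c x′ V ⟩
          col c V x′ ∎)

    via-mate-of-y : col c U x ≡ col c y V → mate (toℕ y) < N → RainbowC5 (AdjPlus G x y) c
    via-mate-of-y Ux≡yV y′<N with mate-vertex leaf-y y′<N
    ... | y′ , leaf-y′ , y~y′ =
      rainbow-C5 leaf-y′ leaf-y (≢-sym (adjacent⇒≢ G y~y′)) (inj₁ (Adj-sym G {y} {y′} y~y′)) λ Uy′≡yV →
        proper U y′ x (U~leaf leaf-y′) (U~leaf leaf-x) (λ { refl → x≁y (Adj-sym G {y} {x} y~y′) })
          (≡.trans Uy′≡yV (≡.sym Ux≡yV))

    rainbow-C5-after-adding : RainbowC5 (AdjPlus G x y) c
    rainbow-C5-after-adding with col c U x ≟ col c y V
    ... | no Ux≢yV = rainbow-C5 leaf-x leaf-y x≢y (inj₂ (inj₁ (refl , refl))) Ux≢yV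
    ... | yes Ux≡yV with mate-in-range-or-last (toℕ<n x) | mate-in-range-or-last (toℕ<n y)
    ... | inj₁ x′<N | _ = via-mate-of-x Ux≡yV x′<N
    ... | inj₂ _ | inj₁ y′<N = via-mate-of-y Ux≡yV y′<N
    ... | inj₂ x-last | inj₂ y-last =
      ⊥-elim (x≢y (toℕ-injective (suc-injective (≡.trans x-last (≡.sym y-last)))))

open Counting adjᴺ

edgeCount-graph : ∀ n → edgeCount (graph n) ≡ edgesBelow n
edgeCount-graph n = ≡.trans (sum-allFin {n} _) (sum-cong-≗ {n} λ i → sum-allFin {n} _)

matesBelow : ℕ → ℕ
matesBelow k = ∑[ i < k ] (if mate (toℕ i) ≡ᵇ k then 1 else 0)

backDegree-leaf : ∀ k → backDegree (2 + k) ≡ 2 + matesBelow k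
backDegree-leaf k = refl

matesBelow-consecutive : ∀ k → matesBelow k + matesBelow (suc k) ≡ 1
matesBelow-consecutive 0 = refl
matesBelow-consecutive 1 = refl
matesBelow-consecutive (suc (suc k)) = matesBelow-consecutive k

backDegree-consecutive-leaves : ∀ k → backDegree (2 + k) + backDegree (3 + k) ≡ 5
backDegree-consecutive-leaves k = begin
  backDegree (2 + k) + backDegree (3 + k)
    ≡⟨ cong₂ _+_ (backDegree-leaf k) (backDegree-leaf (suc k)) ⟩
  (2 + matesBelow k) + (2 + matesBelow (suc k))
    ≡⟨ regroup (matesBelow k) (matesBelow (suc k)) ⟩
  4 + (matesBelow k + matesBelow (suc k))
    ≡⟨ cong (4 +_) (matesBelow-consecutive k) ⟩
  5 ∎
  where
    regroup : ∀ a b → (2 + a) + (2 + b) ≡ 4 + (a + b)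
    regroup = solve-∀

edgesBelow-two-leaves : ∀ k → edgesBelow (4 + k) ≡ edgesBelow (2 + k) + 5
edgesBelow-two-leaves k = begin
  edgesBelow (4 + k)
    ≡⟨ edgesBelow-suc (3 + k) ⟩
  edgesBelow (3 + k) + backDegree (3 + k)
    ≡⟨ cong (_+ backDegree (3 + k)) (edgesBelow-suc (2 + k)) ⟩
  edgesBelow (2 + k) + backDegree (2 + k) + backDegree (3 + k)
    ≡⟨ +-assoc (edgesBelow (2 + k)) _ _ ⟩
  edgesBelow (2 + k) + (backDegree (2 + k) + backDegree (3 + k))
    ≡⟨ cong (edgesBelow (2 + k) +_) (backDegree-consecutive-leaves k) ⟩
  edgesBelow (2 + k) + 5 ∎

edgesBelow-bound : ∀ k → edgesBelow (2 + k) * 2 + 8 ≤ 5 * (2 + k)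
edgesBelow-bound 0 = ≤-refl
edgesBelow-bound 1 = n≤1+n 14
edgesBelow-bound (suc (suc k)) =
  subst₂ _≤_ (≡.sym lhs) (rhs k) (+-monoˡ-≤ 10 (edgesBelow-bound k))
  where
    expand : ∀ e → (e + 5) * 2 + 8 ≡ (e * 2 + 8) + 10
    expand = solve-∀
    lhs : edgesBelow (4 + k) * 2 + 8 ≡ (edgesBelow (2 + k) * 2 + 8) + 10
    lhs = ≡.trans (cong (λ e → e * 2 + 8) (edgesBelow-two-leaves k)) (expand (edgesBelow (2 + k)))
    rhs : ∀ k → 5 * (2 + k) + 10 ≡ 5 * (4 + k)
    rhs = solve-∀

≤-half∸ : ∀ {e k} → e * 2 + 8 ≤ k → e ≤ k / 2 ∸ 4
≤-half∸ {e} {k} le =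
  m+n≤o⇒m≤o∸n e (subst (_≤ k / 2) (m*n/n≡m (e + 4) 2) (/-monoˡ-≤ 2 (subst (_≤ k) (double e) le)))
  where
    double : ∀ e → e * 2 + 8 ≡ (e + 4) * 2
    double = solve-∀

theorem8 : ∀ (n : ℕ) → 9 ≤ n →
    Σ (Graph n) λ G → RainbowC5Saturated G × edgeCount G ≤ (5 * n) / 2 ∸ 4
theorem8 (suc (suc m)) (s≤s (s≤s 7≤m)) =
  graph (2 + m) ,
  ((colouring (2 + m) , colouring-proper (2 + m) , no-rainbow-C5 m 7≤m) ,
   λ x y x≢y x≁y c proper → rainbow-C5-after-adding m 7≤m x≢y x≁y {c} proper) ,
  subst (_≤ (5 * (2 + m)) / 2 ∸ 4) (≡.sym (edgeCount-graph (2 + m))) (≤-half∸ (edgesBelow-bound m))
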